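{- For any finite groups $G,H$ we have $\delta(G\times H)\geq\delta(G)\delta(H)$. Moreover, if $\gcd(|G|,|H|)=1$, then $\delta(G\times H)=\delta(G)\delta(H)$.
   Context: For a finite group $G$, $\delta(G)=\sum_{g\in G}\frac{1}{\mathrm{ord}(g)}$, where $\mathrm{ord}(g)$ is the order of $g$. -}

module Defs where

open import Data.Nat using (ℕ; zero; suc; _*_)
open import Data.Fin using (Fin)
import Data.Fin as Fin
open import Data.Fin.Properties using (*↔×)
open import Data.Product using (_×_; _,_; proj₁; proj₂)
open import Data.Product.Function.NonDependent.Propositional using (_×-↔_)
open import Data.List using (List; map; foldr; allFin)
open import Data.Integer using (+_)
open import Data.Rational using (ℚ; 0ℚ; _/_)
import Data.Rational as ℚ
open import Function.Bundles using (_↔_; Inverse)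
open import Function.Properties.Inverse using (↔-trans)
open import Algebra.Structures using (IsGroup)
open import Relation.Binary.PropositionalEquality
  using (_≡_; refl; cong; cong₂; sym; trans; isEquivalence)
open import Relation.Nullary using (Dec; yes; no)

record FiniteGroup : Set₁ where
  infixl 7 _∙_
  field
    Carrier : Set
    _∙_     : Carrier → Carrier → Carrier
    ε       : Carrier
    _⁻¹     : Carrier → Carrier
    isGroup : IsGroup _≡_ _∙_ ε _⁻¹
    size    : ℕ
    enum    : Fin size ↔ Carrier

  open IsGroup isGroup public using (assoc; identityˡ; identityʳ; inverseˡ; inverseʳ)

  _≟_ : (x y : Carrier) → Dec (x ≡ y)
  x ≟ y with Inverse.from enum x Fin.≟ Inverse.from enum y
  ... | yes p = yes (trans (sym (Inverse.strictlyInverseˡ enum x))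
                     (trans (cong (Inverse.to enum) p) (Inverse.strictlyInverseˡ enum y)))
  ... | no ¬p = no (λ eq → ¬p (cong (Inverse.from enum) eq))

  pow : Carrier → ℕ → Carrier
  pow g zero    = ε
  pow g (suc k) = g ∙ pow g k

  -- search for the least k' ≥ k+1 with g^(k') = ε, returning k'-1,
  -- within the given fuel
  ordSearch : Carrier → ℕ → ℕ → ℕ
  ordSearch g k zero = k
  ordSearch g k (suc f) with pow g (suc k) ≟ ε
  ... | yes _ = k
  ... | no _  = ordSearch g (suc k) f

  -- order of g: least positive k with g^k = ε  (it is ≤ |G|, so the
  -- search with fuel |G| always finds it)
  ord : Carrier → ℕ
  ord g = suc (ordSearch g 0 size)

  ordPred : Carrier → ℕ
  ordPred g = ordSearch g 0 size

open FiniteGroup public using (Carrier; size; ord)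

sumℚ : List ℚ → ℚ
sumℚ = foldr ℚ._+_ 0ℚ

δ : FiniteGroup → ℚ
δ G = sumℚ (map (λ i → (+ 1) / FiniteGroup.ord G (Inverse.to (FiniteGroup.enum G) i))
               (allFin (FiniteGroup.size G)))

_×G_ : FiniteGroup → FiniteGroup → FiniteGroup
G ×G H = record
  { Carrier = G.Carrier × H.Carrier
  ; _∙_ = λ x y → (proj₁ x G.∙ proj₁ y , proj₂ x H.∙ proj₂ y)
  ; ε = (G.ε , H.ε)
  ; _⁻¹ = λ x → (proj₁ x G.⁻¹ , proj₂ x H.⁻¹)
  ; isGroup = record
    { isMonoid = record
      { isSemigroup = record
        { isMagma = record
          { isEquivalence = isEquivalence
          ; ∙-cong = λ { refl refl → refl } }
        ; assoc = λ x y z → cong₂ _,_ (G.assoc _ _ _) (H.assoc _ _ _) }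
      ; identity = (λ x → cong₂ _,_ (G.identityˡ _) (H.identityˡ _))
                 , (λ x → cong₂ _,_ (G.identityʳ _) (H.identityʳ _)) }
    ; inverse = (λ x → cong₂ _,_ (G.inverseˡ _) (H.inverseˡ _))
              , (λ x → cong₂ _,_ (G.inverseʳ _) (H.inverseʳ _))
    ; ⁻¹-cong = λ { refl → refl } }
  ; size = G.size * H.size
  ; enum = ↔-trans *↔× (G.enum ×-↔ H.enum)
  }
  where
    module G = FiniteGroup G
    module H = FiniteGroup H

-- Writing δ(G) and δ(H) as sums over G and H, the product δ(G) δ(H) is the
-- sum over pairs (g , h) of 1 / (ord g · ord h), while δ(G × H) is the sum of
-- 1 / ord (g , h).  Since (g , h)^k = (g^k , h^k), ord (g , h) divides
-- ord g · ord h and is divisible by both factors; so 1 / ord (g , h) is at least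
-- 1 / (ord g · ord h), with equality when ord g and ord h are coprime.  By
-- Lagrange, ord g ∣ |G| and ord h ∣ |H|, so coprimality of |G| and |H| suffices.
module Submission where

open import Algebra.Bundles using (Monoid; Group; CommutativeRing)
open import Data.Fin using (Fin; toℕ; _↑ˡ_; _↑ʳ_; combine; remQuot)
import Data.Fin as Fin
import Data.Fin.Properties as Finₚ
open import Data.Integer using (+_)
open import Data.List using (List; []; _∷_; length; filter; lookup; map; allFin; tabulate)
open import Data.List.Membership.Propositional using (_∈_)
open import Data.List.Membership.Propositional.Properties
  using (∈-filter⁺; ∈-filter⁻; ∈-lookup; ∈-map⁺; ∈-allFin)
open import Data.List.Relation.Unary.Unique.Propositional using (Unique)
open import Data.Nat using (zero; suc; NonZero)
import Data.Nat as ℕ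
open import Data.Product using (_×_; _,_; proj₁; proj₂; ∃)
open import Data.Vec.Functional using (Vector)
open import Function using (_∘_; Injective)
open import Function.Bundles using (Inverse)
open import Relation.Binary.PropositionalEquality
  using (_≡_; _≢_; refl; sym; trans; cong; cong₂; subst; subst₂; module ≡-Reasoning)
open import Relation.Nullary using (yes; no; contradiction)
open import Relation.Unary using (Pred; Decidable)
open import Relation.Unary.Properties using (∁?)

module ListCounting {A : Set} where
  open import Data.Nat using (_+_)
  import Data.List.Relation.Unary.All as All
  open import Data.List.Relation.Unary.AllPairs using (_∷_)
  import Data.List.Relation.Unary.Any as Any
  open import Data.List.Relation.Unary.Any.Properties using (lookup-index)
  open import Data.Nat.Properties using (+-suc)

  length-filter+length-filter-∁ : ∀ {p} {P : Pred A p} (P? : Decidable P) xs →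
    length (filter P? xs) + length (filter (∁? P?) xs) ≡ length xs
  length-filter+length-filter-∁ P? [] = refl
  length-filter+length-filter-∁ P? (x ∷ xs) with P? x
  ... | yes _ = cong suc (length-filter+length-filter-∁ P? xs)
  ... | no _  = trans (+-suc _ _) (cong suc (length-filter+length-filter-∁ P? xs))

  lookup-injective : ∀ {xs : List A} → Unique xs → Injective _≡_ _≡_ (lookup xs)
  lookup-injective (_ ∷ _)  {Fin.zero}  {Fin.zero}  _  = refl
  lookup-injective (x∉ ∷ _) {Fin.zero}  {Fin.suc j} eq = contradiction eq (All.lookup x∉ (∈-lookup j))
  lookup-injective (x∉ ∷ _) {Fin.suc i} {Fin.zero}  eq = contradiction (sym eq) (All.lookup x∉ (∈-lookup i))
  lookup-injective (_ ∷ u)  {Fin.suc i} {Fin.suc j} eq = cong Fin.suc (lookup-injective u eq)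

  length-of-unique-image : ∀ {n} {xs : List A} (f : Fin n → A) → Unique xs →
    Injective _≡_ _≡_ f → (∀ k → f k ∈ xs) → (∀ {x} → x ∈ xs → ∃ λ k → x ≡ f k) →
    length xs ≡ n
  length-of-unique-image {xs = xs} f xs-unique f-inj f∈xs image =
    Finₚ.cantor-schröder-bernstein preimage-injective index-injective
    where
      preimage-injective : Injective _≡_ _≡_ (λ i → proj₁ (image (∈-lookup i)))
      preimage-injective {i} {j} eq = lookup-injective xs-unique
        (trans (proj₂ (image (∈-lookup i))) (trans (cong f eq) (sym (proj₂ (image (∈-lookup j))))))
      index-injective : Injective _≡_ _≡_ (λ k → Any.index (f∈xs k))
      index-injective {k} {l} eq = f-inj
        (trans (lookup-index (f∈xs k)) (trans (cong (lookup xs) eq) (sym (lookup-index (f∈xs l)))))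

open ListCounting

module MonoidSum {c ℓ} (M : Monoid c ℓ) where
  open import Data.Nat using (_+_; _*_)
  open Monoid M using (Carrier; _≈_; _∙_; setoid; ∙-congˡ; assoc; identityˡ)
    renaming (refl to ≈-refl; sym to ≈-sym)
  open import Algebra.Properties.Monoid.Sum M using (sum; sum-syntax)
  open import Relation.Binary.Reasoning.Setoid setoid

  sum-↑ : ∀ m n (f : Vector Carrier (m + n)) →
    sum f ≈ sum (f ∘ (_↑ˡ n)) ∙ sum (f ∘ (m ↑ʳ_))
  sum-↑ zero n f = ≈-sym (identityˡ _)
  sum-↑ (suc m) n f = begin
    f Fin.zero ∙ sum (f ∘ Fin.suc)
      ≈⟨ ∙-congˡ (sum-↑ m n (f ∘ Fin.suc)) ⟩
    f Fin.zero ∙ (sum (f ∘ Fin.suc ∘ (_↑ˡ n)) ∙ sum (f ∘ Fin.suc ∘ (m ↑ʳ_)))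
      ≈⟨ ≈-sym (assoc _ _ _) ⟩
    (f Fin.zero ∙ sum (f ∘ Fin.suc ∘ (_↑ˡ n))) ∙ sum (f ∘ Fin.suc ∘ (m ↑ʳ_)) ∎

  sum-combine : ∀ m n (f : Vector Carrier (m * n)) →
    sum f ≈ ∑[ i < m ] ∑[ j < n ] f (combine i j)
  sum-combine zero n f = ≈-refl
  sum-combine (suc m) n f = begin
    sum f                                            ≈⟨ sum-↑ n (m * n) f ⟩
    sum (f ∘ (_↑ˡ (m * n))) ∙ sum (f ∘ (n ↑ʳ_))        ≈⟨ ∙-congˡ (sum-combine m n (f ∘ (n ↑ʳ_))) ⟩
    sum (f ∘ (_↑ˡ (m * n))) ∙ (∑[ i < m ] ∑[ j < n ] f (n ↑ʳ combine i j)) ∎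

open import Defs using (FiniteGroup; sumℚ; δ; _×G_)

module RationalSum where
  open import Data.Rational using (ℚ; _≤_; _+_)
  import Data.Rational.Properties as ℚₚ
  open import Data.List.Properties using (map-tabulate)
  open import Algebra.Properties.Semiring.Sum (CommutativeRing.semiring ℚₚ.+-*-commutativeRing) public
    using (sum; sum-syntax; sum-cong-≗; *-distribˡ-sum; *-distribʳ-sum)
  open MonoidSum ℚₚ.+-0-monoid public using (sum-combine)

  sumℚ-tabulate : ∀ n (f : Vector ℚ n) → sumℚ (tabulate f) ≡ sum f
  sumℚ-tabulate zero f = refl
  sumℚ-tabulate (suc n) f = cong (_+_ (f Fin.zero)) (sumℚ-tabulate n (f ∘ Fin.suc))

  sumℚ-map-allFin : ∀ n (f : Vector ℚ n) → sumℚ (map f (allFin n)) ≡ sum f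
  sumℚ-map-allFin n f = trans (cong sumℚ (map-tabulate (λ i → i) f)) (sumℚ-tabulate n f)

  sum-cong₂ : ∀ {m n} {f g : Fin m → Fin n → ℚ} → (∀ i j → f i j ≡ g i j) →
    ∑[ i < m ] ∑[ j < n ] f i j ≡ ∑[ i < m ] ∑[ j < n ] g i j
  sum-cong₂ {m} {n} f≡g = sum-cong-≗ {m} (λ i → sum-cong-≗ {n} (f≡g i))

  sum-mono-≤ : ∀ {n} {f g : Vector ℚ n} → (∀ i → f i ≤ g i) → sum f ≤ sum g
  sum-mono-≤ {zero} f≤g = ℚₚ.≤-refl
  sum-mono-≤ {suc n} f≤g = ℚₚ.+-mono-≤ (f≤g Fin.zero) (sum-mono-≤ (f≤g ∘ Fin.suc))

  sum-mono-≤₂ : ∀ {m n} {f g : Fin m → Fin n → ℚ} → (∀ i j → f i j ≤ g i j) →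
    ∑[ i < m ] ∑[ j < n ] f i j ≤ ∑[ i < m ] ∑[ j < n ] g i j
  sum-mono-≤₂ {m} {n} f≤g = sum-mono-≤ {m} (λ i → sum-mono-≤ {n} (f≤g i))

open RationalSum

module Reciprocal where
  open import Data.Rational using (ℚ; _/_; _*_; _≤_; toℚᵘ)
  import Data.Rational.Properties as ℚₚ
  import Data.Rational.Unnormalised as ℚᵘ
  import Data.Rational.Unnormalised.Properties as ℚᵘₚ
  import Data.Integer as ℤ
  import Data.Integer.Properties as ℤₚ
  open import Data.Nat.Properties using (m*n≢0)

  -- + 1 / suc k  unfolds to  fromℚᵘ (mkℚᵘ (+ 1) k).
  toℚᵘ-1/suc : ∀ k → toℚᵘ (+ 1 / suc k) ℚᵘ.≃ ℚᵘ.mkℚᵘ (+ 1) k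
  toℚᵘ-1/suc k = ℚₚ.toℚᵘ-fromℚᵘ (ℚᵘ.mkℚᵘ (+ 1) k)

  1/-cong : ∀ {m n} .{{_ : NonZero m}} .{{_ : NonZero n}} → m ≡ n → + 1 / m ≡ + 1 / n
  1/-cong refl = refl

  1/-*-1/ : ∀ m n .{{_ : NonZero m}} .{{_ : NonZero n}} →
    (+ 1 / m) * (+ 1 / n) ≡ (+ 1 / (m ℕ.* n)) {{m*n≢0 m n}}
  1/-*-1/ (suc a) (suc b) = ℚₚ.toℚᵘ-injective (begin
    toℚᵘ ((+ 1 / suc a) * (+ 1 / suc b))            ≈⟨ ℚₚ.toℚᵘ-homo-* (+ 1 / suc a) (+ 1 / suc b) ⟩
    toℚᵘ (+ 1 / suc a) ℚᵘ.* toℚᵘ (+ 1 / suc b)      ≈⟨ ℚᵘₚ.*-cong (toℚᵘ-1/suc a) (toℚᵘ-1/suc b) ⟩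
    ℚᵘ.mkℚᵘ (+ 1) a ℚᵘ.* ℚᵘ.mkℚᵘ (+ 1) b            ≈⟨ ℚᵘ.*≡* refl ⟩
    ℚᵘ.mkℚᵘ (+ 1) (b ℕ.+ a ℕ.* suc b)              ≈⟨ ℚᵘₚ.≃-sym (toℚᵘ-1/suc (b ℕ.+ a ℕ.* suc b)) ⟩
    toℚᵘ (+ 1 / (suc a ℕ.* suc b))                  ∎)
    where open ℚᵘₚ.≃-Reasoning

  1/-antimono-≤ : ∀ {m n} .{{_ : NonZero m}} .{{_ : NonZero n}} → m ℕ.≤ n → + 1 / n ≤ + 1 / m
  1/-antimono-≤ {suc m} {suc n} m≤n = ℚₚ.toℚᵘ-cancel-≤
    (ℚᵘₚ.≤-respʳ-≃ (ℚᵘₚ.≃-sym (toℚᵘ-1/suc m)) (ℚᵘₚ.≤-respˡ-≃ (ℚᵘₚ.≃-sym (toℚᵘ-1/suc n))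
      (ℚᵘ.*≤* (subst₂ ℤ._≤_ (sym (ℤₚ.*-identityˡ _)) (sym (ℤₚ.*-identityˡ _)) (ℤ.+≤+ m≤n)))))

open Reciprocal

module FiniteGroupProperties (G : FiniteGroup) where
  open FiniteGroup G
  open import Data.Nat using (_+_; _*_; _≤_; _<_; z≤n; s≤s; s≤s⁻¹)
  open import Data.Nat.Properties
    using (+-suc; +-identityʳ; m≤n+m; n<1+n; ≤-trans; <⇒≱; m≤n⇒∃[o]m+o≡n; <-cmp; m≤n⇒m<n∨m≡n)
  open import Data.Nat.Divisibility using (_∣_; _∣0; ∣-reflexive; ∣m∣n⇒∣m+n; m%n≡0⇒n∣m)
  open import Data.Nat.DivMod using (_%_; _/_; m≡m%n+[m/n]*n; m%n<n)
  open import Data.Nat.Induction using (<-wellFounded)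
  open import Data.Sum using (inj₁; inj₂)
  open import Data.List.Properties using (length-map; length-tabulate)
  open import Data.List.Relation.Unary.Any using (here)
  open import Induction.WellFounded using (Acc; acc)
  open import Relation.Binary using (tri<; tri≈; tri>)
  import Data.List.Relation.Unary.Unique.Propositional.Properties as Uniqueₚ
  open import Function.Bundles using (Injection)
  open import Function.Properties.Inverse using (↔⇒↣; ↔-sym)
  open ≡-Reasoning

  group : Group _ _
  group = record { isGroup = isGroup }

  open import Algebra.Properties.Group group using (∙-cancelˡ; ∙-cancelʳ)

  pow-+ : ∀ g m n → pow g (m + n) ≡ pow g m ∙ pow g n
  pow-+ g zero n = sym (identityˡ _)
  pow-+ g (suc m) n = trans (cong (g ∙_) (pow-+ g m n)) (sym (assoc _ _ _))

  pow-*-ε : ∀ g n q → pow g n ≡ ε → pow g (q * n) ≡ ε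
  pow-*-ε g n zero gⁿ≡ε = refl
  pow-*-ε g n (suc q) gⁿ≡ε = begin
    pow g (n + q * n)        ≡⟨ pow-+ g n (q * n) ⟩
    pow g n ∙ pow g (q * n)  ≡⟨ cong₂ _∙_ gⁿ≡ε (pow-*-ε g n q gⁿ≡ε) ⟩
    ε ∙ ε                    ≡⟨ identityˡ ε ⟩
    ε                        ∎

  pow-repeat⇒pow≡ε : ∀ g i d → pow g i ≡ pow g (suc i + d) → pow g (suc d) ≡ ε
  pow-repeat⇒pow≡ε g i d eq = ∙-cancelˡ (pow g i) _ _ (begin
    pow g i ∙ pow g (suc d)  ≡⟨ sym (pow-+ g i (suc d)) ⟩
    pow g (i + suc d)        ≡⟨ cong (pow g) (+-suc i d) ⟩
    pow g (suc i + d)        ≡⟨ sym eq ⟩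
    pow g i                  ≡⟨ sym (identityʳ _) ⟩
    pow g i ∙ ε              ∎)

  ordSearch-below⇒pow≢ε : ∀ g k f j → k ≤ j → j < ordSearch g k f → pow g (suc j) ≢ ε
  ordSearch-below⇒pow≢ε g k zero j k≤j j<k = contradiction k≤j (<⇒≱ j<k)
  ordSearch-below⇒pow≢ε g k (suc f) j k≤j j<r with pow g (suc k) ≟ ε
  ... | yes _ = contradiction k≤j (<⇒≱ j<r)
  ... | no gᵏ⁺¹≢ε with m≤n⇒m<n∨m≡n k≤j
  ...   | inj₂ refl = gᵏ⁺¹≢ε
  ...   | inj₁ k<j = ordSearch-below⇒pow≢ε g (suc k) f j k<j j<r

  ordSearch-finds : ∀ g k f j → k ≤ j → j < k + f → pow g (suc j) ≡ ε →
                    pow g (suc (ordSearch g k f)) ≡ ε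
  ordSearch-finds g k zero j k≤j j<k+0 _ = contradiction k≤j (<⇒≱ (subst (j <_) (+-identityʳ k) j<k+0))
  ordSearch-finds g k (suc f) j k≤j j<r gʲ⁺¹≡ε with pow g (suc k) ≟ ε
  ... | yes gᵏ⁺¹≡ε = gᵏ⁺¹≡ε
  ... | no gᵏ⁺¹≢ε with m≤n⇒m<n∨m≡n k≤j
  ...   | inj₂ refl = contradiction gʲ⁺¹≡ε gᵏ⁺¹≢ε
  ...   | inj₁ k<j = ordSearch-finds g (suc k) f j k<j (subst (j <_) (+-suc k f) j<r) gʲ⁺¹≡ε

  -- Pigeonhole on g⁰, …, g^|G|: two of them coincide.
  pow≡ε-within-size : ∀ g → ∃ λ j → j < size × pow g (suc j) ≡ ε
  pow≡ε-within-size g with Finₚ.pigeonhole (n<1+n size) (λ i → Inverse.from enum (pow g (toℕ i)))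
  ... | i , j , i<j , eq with m≤n⇒∃[o]m+o≡n i<j
  ...   | d , i+1+d≡j = d , d<size , pow-repeat⇒pow≡ε g (toℕ i) d gⁱ≡gⁱ⁺¹⁺ᵈ
    where
      d<size : d < size
      d<size = ≤-trans (s≤s (m≤n+m d (toℕ i))) (subst (_≤ size) (sym i+1+d≡j) (s≤s⁻¹ (Finₚ.toℕ<n j)))
      gⁱ≡gⁱ⁺¹⁺ᵈ : pow g (toℕ i) ≡ pow g (suc (toℕ i) + d)
      gⁱ≡gⁱ⁺¹⁺ᵈ = trans (Injection.injective (↔⇒↣ (↔-sym enum)) eq) (cong (pow g) (sym i+1+d≡j))

  pow-ord : ∀ g → pow g (ord g) ≡ ε
  pow-ord g with pow≡ε-within-size g
  ... | j , j<size , gʲ⁺¹≡ε = ordSearch-finds g 0 size j z≤n j<size gʲ⁺¹≡ε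

  ord-minimal : ∀ g d → suc d < ord g → pow g (suc d) ≢ ε
  ord-minimal g d (s≤s d<ordPred) = ordSearch-below⇒pow≢ε g 0 size d z≤n d<ordPred

  pow-%-ord : ∀ g k → pow g (k % ord g) ≡ pow g k
  pow-%-ord g k = begin
    pow g (k % ord g)                                     ≡⟨ sym (identityʳ _) ⟩
    pow g (k % ord g) ∙ ε                                 ≡⟨ cong (pow g (k % ord g) ∙_) (sym (pow-*-ε g (ord g) (k / ord g) (pow-ord g))) ⟩
    pow g (k % ord g) ∙ pow g (k / ord g * ord g)         ≡⟨ sym (pow-+ g (k % ord g) _) ⟩
    pow g (k % ord g + k / ord g * ord g)                 ≡⟨ cong (pow g) (sym (m≡m%n+[m/n]*n k (ord g))) ⟩
    pow g k                                               ∎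

  pow≡ε⇒ord∣ : ∀ g k → pow g k ≡ ε → ord g ∣ k
  pow≡ε⇒ord∣ g k gᵏ≡ε with k % ord g in r≡ | m%n<n k (ord g) | trans (pow-%-ord g k) gᵏ≡ε
  ... | zero  | _     | _    = m%n≡0⇒n∣m k (ord g) r≡
  ... | suc r | r<ord | gʳ≡ε = contradiction gʳ≡ε (ord-minimal g r r<ord)

  pow≢-below-ord : ∀ g {i j} → i < j → j < ord g → pow g i ≢ pow g j
  pow≢-below-ord g {i} i<j j<ord eq with m≤n⇒∃[o]m+o≡n i<j
  ... | d , refl = ord-minimal g d (≤-trans (s≤s (s≤s (m≤n+m d i))) j<ord) (pow-repeat⇒pow≡ε g i d eq)

  pow-injective-below-ord : ∀ g {i j} → i < ord g → j < ord g → pow g i ≡ pow g j → i ≡ j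
  pow-injective-below-ord g {i} {j} i<ord j<ord eq with <-cmp i j
  ... | tri< i<j _ _ = contradiction eq (pow≢-below-ord g i<j j<ord)
  ... | tri≈ _ i≡j _ = i≡j
  ... | tri> _ _ j<i = contradiction (sym eq) (pow≢-below-ord g j<i i<ord)

  pow-pred : ∀ g (k : Fin (ord g)) → ∃ λ (k′ : Fin (ord g)) → pow g (toℕ k) ≡ g ∙ pow g (toℕ k′)
  pow-pred g Fin.zero = Fin.fromℕ (ordPred g) , (begin
    ε                                       ≡⟨ sym (pow-ord g) ⟩
    g ∙ pow g (ordPred g)                   ≡⟨ cong (λ n → g ∙ pow g n) (sym (Finₚ.toℕ-fromℕ (ordPred g))) ⟩
    g ∙ pow g (toℕ (Fin.fromℕ (ordPred g))) ∎)
  pow-pred g (Fin.suc k) = Fin.inject₁ k , cong (λ n → g ∙ pow g n) (sym (Finₚ.toℕ-inject₁ k))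

  module Cosets (g : Carrier) where

    coset : Carrier → Fin (ord g) → Carrier
    coset a k = pow g (toℕ k) ∙ a

    coset-injective : ∀ a → Injective _≡_ _≡_ (coset a)
    coset-injective a eq = Finₚ.toℕ-injective
      (pow-injective-below-ord g (Finₚ.toℕ<n _) (Finₚ.toℕ<n _) (∙-cancelʳ a _ _ eq))

    InCoset : Carrier → Pred Carrier _
    InCoset a x = ∃ λ k → x ≡ coset a k

    inCoset? : ∀ a → Decidable (InCoset a)
    inCoset? a x = Finₚ.any? (λ k → x ≟ coset a k)

    InCoset-g∙⁻ : ∀ {a x} → InCoset a (g ∙ x) → InCoset a x
    InCoset-g∙⁻ {a} {x} (k , g∙x≡) with pow-pred g k
    ... | k′ , gᵏ≡ = k′ , ∙-cancelˡ g _ _ (begin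
      g ∙ x                          ≡⟨ g∙x≡ ⟩
      pow g (toℕ k) ∙ a              ≡⟨ cong (_∙ a) gᵏ≡ ⟩
      (g ∙ pow g (toℕ k′)) ∙ a       ≡⟨ assoc _ _ _ ⟩
      g ∙ coset a k′                 ∎)

    Closed : List Carrier → Set
    Closed xs = ∀ {x} → x ∈ xs → g ∙ x ∈ xs

    pow∙∈ : ∀ {xs a} → Closed xs → a ∈ xs → ∀ k → pow g k ∙ a ∈ xs
    pow∙∈ {xs} {a} closed a∈xs zero = subst (_∈ xs) (sym (identityˡ a)) a∈xs
    pow∙∈ {xs} {a} closed a∈xs (suc k) = subst (_∈ xs) (sym (assoc _ _ _)) (closed (pow∙∈ closed a∈xs k))

    length-filter-coset : ∀ {xs a} → Unique xs → Closed xs → a ∈ xs →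
      length (filter (inCoset? a) xs) ≡ ord g
    length-filter-coset {xs} {a} unique closed a∈xs = length-of-unique-image (coset a)
      (Uniqueₚ.filter⁺ (inCoset? a) unique) (coset-injective a)
      (λ k → ∈-filter⁺ (inCoset? a) (pow∙∈ closed a∈xs (toℕ k)) (k , refl))
      (λ x∈ → proj₂ (∈-filter⁻ (inCoset? a) {xs = xs} x∈))

    filter-∁-Closed : ∀ {xs} a → Closed xs → Closed (filter (∁? (inCoset? a)) xs)
    filter-∁-Closed {xs} a closed x∈ with ∈-filter⁻ (∁? (inCoset? a)) {xs = xs} x∈
    ... | x∈xs , x∉coset = ∈-filter⁺ (∁? (inCoset? a)) (closed x∈xs) (x∉coset ∘ InCoset-g∙⁻)

    -- A closed list is the disjoint union of the cosets ⟨g⟩a it meets.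
    ord∣length : ∀ xs → Acc _<_ (length xs) → Unique xs → Closed xs → ord g ∣ length xs
    ord∣length [] _ _ _ = _ ∣0
    ord∣length xs@(a ∷ _) (acc rec) unique closed =
      subst (ord g ∣_) split (∣m∣n⇒∣m+n (∣-reflexive (sym coset-length)) rest-divisible)
      where
        rest = filter (∁? (inCoset? a)) xs
        split : length (filter (inCoset? a) xs) + length rest ≡ length xs
        split = length-filter+length-filter-∁ (inCoset? a) xs
        coset-length : length (filter (inCoset? a) xs) ≡ ord g
        coset-length = length-filter-coset unique closed (here refl)
        rest-shorter : length rest < length xs
        rest-shorter = subst (length rest <_) (trans (cong (_+ length rest) (sym coset-length)) split)
          (s≤s (m≤n+m (length rest) (ordPred g)))
        rest-divisible : ord g ∣ length rest
        rest-divisible = ord∣length rest (rec rest-shorter)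
          (Uniqueₚ.filter⁺ (∁? (inCoset? a)) unique) (filter-∁-Closed a closed)

  ord∣size : ∀ g → ord g ∣ size
  ord∣size g = subst (ord g ∣_) length-elements
    (ord∣length elements (<-wellFounded _) elements-unique (λ _ → ∈-elements _))
    where
      open Cosets g
      elements : List Carrier
      elements = map (Inverse.to enum) (allFin size)
      length-elements : length elements ≡ size
      length-elements = trans (length-map _ (allFin size)) (length-tabulate _)
      elements-unique : Unique elements
      elements-unique = Uniqueₚ.map⁺ (Injection.injective (↔⇒↣ enum)) (Uniqueₚ.allFin⁺ size)
      ∈-elements : ∀ x → x ∈ elements
      ∈-elements x = subst (_∈ elements) (Inverse.strictlyInverseˡ enum x)
        (∈-map⁺ (Inverse.to enum) (∈-allFin (Inverse.from enum x)))

module CoprimeDivisibility where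
  open import Data.Nat using (_*_)
  open import Data.Nat.Coprimality using (Coprime; coprime-divisor)
  open import Data.Nat.Divisibility using (_∣_; divides; *-monoˡ-∣)
  open import Data.Nat.Properties using (*-comm)

  coprime⇒*∣ : ∀ {m n o} → Coprime m n → m ∣ o → n ∣ o → m * n ∣ o
  coprime⇒*∣ {m} {n} coprime m∣o (divides q o≡q*n) = subst (m * n ∣_) (sym o≡q*n)
    (*-monoˡ-∣ n (coprime-divisor coprime (subst (m ∣_) (trans o≡q*n (*-comm q n)) m∣o)))

open CoprimeDivisibility

module DirectProductOrder (G H : FiniteGroup) where
  open import Data.Nat using (_*_; _≤_)
  open import Data.Nat.Coprimality using (Coprime; gcd≡1⇒coprime)
  open import Data.Nat.Divisibility using (_∣_; ∣-trans; ∣-antisym; ∣⇒≤)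
  open import Data.Nat.GCD using (gcd)
  open import Data.Nat.Properties using (*-comm)
  private
    module G = FiniteGroup G
    module H = FiniteGroup H
    module G×H = FiniteGroup (G ×G H)
    module Gₚ = FiniteGroupProperties G
    module Hₚ = FiniteGroupProperties H
    module G×Hₚ = FiniteGroupProperties (G ×G H)

  pow-× : ∀ g h k → G×H.pow (g , h) k ≡ (G.pow g k , H.pow h k)
  pow-× g h zero = refl
  pow-× g h (suc k) = cong ((g , h) G×H.∙_) (pow-× g h k)

  ord-×∣* : ∀ g h → G×H.ord (g , h) ∣ G.ord g * H.ord h
  ord-×∣* g h = G×Hₚ.pow≡ε⇒ord∣ (g , h) n (trans (pow-× g h n) (cong₂ _,_ gⁿ≡ε hⁿ≡ε))
    where
      n = G.ord g * H.ord h
      gⁿ≡ε : G.pow g n ≡ G.ε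
      gⁿ≡ε = subst (λ k → G.pow g k ≡ G.ε) (*-comm (H.ord h) (G.ord g))
        (Gₚ.pow-*-ε g (G.ord g) (H.ord h) (Gₚ.pow-ord g))
      hⁿ≡ε : H.pow h n ≡ H.ε
      hⁿ≡ε = Hₚ.pow-*-ε h (H.ord h) (G.ord g) (Hₚ.pow-ord h)

  pow-ord-× : ∀ g h → (G.pow g (G×H.ord (g , h)) , H.pow h (G×H.ord (g , h))) ≡ (G.ε , H.ε)
  pow-ord-× g h = trans (sym (pow-× g h (G×H.ord (g , h)))) (G×Hₚ.pow-ord (g , h))

  ord∣ord-×ˡ : ∀ g h → G.ord g ∣ G×H.ord (g , h)
  ord∣ord-×ˡ g h = Gₚ.pow≡ε⇒ord∣ g (G×H.ord (g , h)) (cong proj₁ (pow-ord-× g h))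

  ord∣ord-×ʳ : ∀ g h → H.ord h ∣ G×H.ord (g , h)
  ord∣ord-×ʳ g h = Hₚ.pow≡ε⇒ord∣ h (G×H.ord (g , h)) (cong proj₂ (pow-ord-× g h))

  ord-×≤* : ∀ g h → G×H.ord (g , h) ≤ G.ord g * H.ord h
  ord-×≤* g h = ∣⇒≤ (ord-×∣* g h)

  ord-×≡* : gcd G.size H.size ≡ 1 → ∀ g h → G×H.ord (g , h) ≡ G.ord g * H.ord h
  ord-×≡* gcd≡1 g h = ∣-antisym (ord-×∣* g h) (coprime⇒*∣ orders-coprime (ord∣ord-×ˡ g h) (ord∣ord-×ʳ g h))
    where
      orders-coprime : Coprime (G.ord g) (H.ord h)
      orders-coprime (d∣ord-g , d∣ord-h) =
        gcd≡1⇒coprime gcd≡1 (∣-trans d∣ord-g (Gₚ.ord∣size g) , ∣-trans d∣ord-h (Hₚ.ord∣size h))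

module DeltaOfProduct (G H : FiniteGroup) where
  open import Data.Rational using (ℚ; _/_; _*_)
  open import Data.Fin.Properties using (remQuot-combine)
  open ≡-Reasoning
  private
    module G = FiniteGroup G
    module H = FiniteGroup H
    module G×H = FiniteGroup (G ×G H)

  gᵢ : Fin G.size → G.Carrier
  gᵢ = Inverse.to G.enum

  hⱼ : Fin H.size → H.Carrier
  hⱼ = Inverse.to H.enum

  δ-as-sum : ∀ K → let open FiniteGroup K in δ K ≡ ∑[ i < size ] (+ 1 / ord (Inverse.to enum i))
  δ-as-sum K = sumℚ-map-allFin (FiniteGroup.size K) _

  δ-×G-as-double-sum : δ (G ×G H) ≡ ∑[ i < G.size ] ∑[ j < H.size ] (+ 1 / G×H.ord (gᵢ i , hⱼ j))
  δ-×G-as-double-sum = begin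
    δ (G ×G H)                                                          ≡⟨ δ-as-sum (G ×G H) ⟩
    ∑[ k < G.size ℕ.* H.size ] f (remQuot H.size k)                     ≡⟨ sum-combine G.size H.size (f ∘ remQuot H.size) ⟩
    ∑[ i < G.size ] ∑[ j < H.size ] f (remQuot H.size (combine i j))    ≡⟨ sum-cong₂ (λ i j → cong f (remQuot-combine i j)) ⟩
    ∑[ i < G.size ] ∑[ j < H.size ] f (i , j)                           ∎
    where
      f : Fin G.size × Fin H.size → ℚ
      f (i , j) = + 1 / G×H.ord (gᵢ i , hⱼ j)

  δ*δ-as-double-sum : δ G * δ H ≡ ∑[ i < G.size ] ∑[ j < H.size ] (+ 1 / (G.ord (gᵢ i) ℕ.* H.ord (hⱼ j)))
  δ*δ-as-double-sum = begin
    δ G * δ H                                      ≡⟨ cong₂ _*_ (δ-as-sum G) (δ-as-sum H) ⟩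
    (∑[ i < G.size ] a i) * (∑[ j < H.size ] b j)  ≡⟨ *-distribʳ-sum (∑[ j < H.size ] b j) a ⟩
    ∑[ i < G.size ] (a i * ∑[ j < H.size ] b j)    ≡⟨ sum-cong-≗ {G.size} (λ i → *-distribˡ-sum (a i) b) ⟩
    ∑[ i < G.size ] ∑[ j < H.size ] (a i * b j)    ≡⟨ sum-cong₂ (λ i j → 1/-*-1/ (G.ord (gᵢ i)) (H.ord (hⱼ j))) ⟩
    ∑[ i < G.size ] ∑[ j < H.size ] (+ 1 / (G.ord (gᵢ i) ℕ.* H.ord (hⱼ j))) ∎
    where
      a : Vector ℚ G.size
      a i = + 1 / G.ord (gᵢ i)
      b : Vector ℚ H.size
      b j = + 1 / H.ord (hⱼ j)

open import Data.Nat.GCD using (gcd)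
open import Data.Rational using (_≤_; _*_)
open import Defs using (size)

lemma5p2 : (G H : FiniteGroup) →
    (δ G * δ H ≤ δ (G ×G H)) ×
    (gcd (size G) (size H) ≡ 1 → δ (G ×G H) ≡ δ G * δ H)
lemma5p2 G H =
    subst₂ _≤_ (sym δ*δ-as-double-sum) (sym δ-×G-as-double-sum)
      (sum-mono-≤₂ {size G} {size H} (λ i j → 1/-antimono-≤ (ord-×≤* _ _)))
  , λ gcd≡1 → trans δ-×G-as-double-sum (trans
      (sum-cong₂ {size G} {size H} (λ i j → 1/-cong (ord-×≡* gcd≡1 _ _)))
      (sym δ*δ-as-double-sum))
  where
    open DeltaOfProduct G H
    open DirectProductOrder G H
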